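{- Let $k,\ell\ge 1$ and let $W=\mathrm{Sym}_k \wr \mathrm{Sym}_\ell \subseteq \mathrm{Sym}_{k\ell}$ be the stabilizer in $\mathrm{Sym}_{k\ell}$ of a fixed partition of $\{1,\ldots,k\ell\}$ into $\ell$ blocks of size $k$ (i.e., the group of permutations mapping each block onto a block). Let $\sigma \in W$ have cycle type $(n_1,\ldots,n_j)$. Then for each index $m\in\{1,\ldots,j\}$ there exist an integer $e\ge 1$ and an index set $I_m \subseteq \{1,\ldots,j\}$ with $m \in I_m$ such that $$ e \mid n_i \ \text{ for all } i \in I_m \quad\text{and}\quad \sum_{i\in I_m} n_i = e\cdot k. $$
   Context: The cycle type of a permutation $\sigma$ is the list $(n_1,\ldots,n_j)$ of the lengths of all orbits of $\langle\sigma\rangle$ on the underlying set, including fixed points; the index $i$ refers to the $i$-th orbit. -}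

module Defs where

open import Data.Nat using (ℕ; zero; suc; _+_; _*_; _≤_; _<_; NonZero)
open import Data.Nat.DivMod using (_/_)
open import Data.Fin using (Fin; toℕ)
open import Data.Fin.Permutation using (Permutation′; _⟨$⟩ʳ_)
open import Data.Fin.Subset using (Subset; inside; outside)
open import Data.Vec using (Vec; []; _∷_; lookup)
open import Data.Product using (∃; ∃-syntax; Σ-syntax; _×_)
open import Relation.Binary.PropositionalEquality using (_≡_; _≢_)
open import Function.Bundles using (_⇔_)

_^[_]_ : ∀ {N} → Permutation′ N → ℕ → Fin N → Fin N
σ ^[ zero ] x = x
σ ^[ suc t ] x = σ ⟨$⟩ʳ (σ ^[ t ] x)

-- The fixed partition of {0,…,kℓ-1} into ℓ blocks of size k:
-- x lies in block ⌊x/k⌋.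
block : ∀ (k ℓ : ℕ) .{{_ : NonZero k}} → Fin (k * ℓ) → ℕ
block k ℓ x = toℕ x / k

InWreath : ∀ (k ℓ : ℕ) .{{_ : NonZero k}} → Permutation′ (k * ℓ) → Set
InWreath k ℓ σ =
  ∀ (b : ℕ) → b < ℓ → ∃[ b' ] (b' < ℓ ×
    (∀ x → (block k ℓ (σ ⟨$⟩ʳ x) ≡ b') ⇔ (block k ℓ x ≡ b)))

IsOrbitLength : ∀ {N} → Permutation′ N → Fin N → ℕ → Set
IsOrbitLength σ x t =
  1 ≤ t × σ ^[ t ] x ≡ x × (∀ s → 1 ≤ s → s < t → σ ^[ s ] x ≢ x)

IsCycleType : ∀ {N} → Permutation′ N → ∀ {j} → Vec ℕ j → Set
IsCycleType {N} σ {j} n = Σ[ r ∈ (Fin j → Fin N) ] (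
    (∀ (i i' : Fin j) t → σ ^[ t ] (r i) ≡ r i' → i ≡ i')
  × (∀ (x : Fin N) → ∃[ i ] ∃[ t ] (σ ^[ t ] (r i) ≡ x))
  × (∀ (i : Fin j) → IsOrbitLength σ (r i) (lookup n i)))

subsetSum : ∀ {j} → Subset j → Vec ℕ j → ℕ
subsetSum [] [] = 0
subsetSum (inside ∷ I) (v ∷ n) = v + subsetSum I n
subsetSum (outside ∷ I) (v ∷ n) = subsetSum I n

-- Let x₀ lie in the m-th orbit and let e be the least e ≥ 1 with σᵉ x₀ in the
-- block of x₀. Since σ permutes the blocks, the blocks B₀, …, B_{e-1} visited by
-- x₀ are pairwise distinct and σ cycles through them, so their union U is
-- σ-invariant of size e·k. Being invariant, U is a union of orbits; taking I to
-- be those orbits, ∑_{i∈I} nᵢ = e·k. An orbit in U returns to its starting block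
-- only after a multiple of e steps, so e divides its length.
module Submission where

open import Data.Fin.Base using (Fin; zero; suc; toℕ; fromℕ<)
open import Data.Fin.Permutation using (Permutation′; _⟨$⟩ʳ_)
open import Data.Fin.Properties
  using (toℕ<n; toℕ-injective; toℕ-fromℕ<; any?; punchInᵢ≢i)
  renaming (_≟_ to _≟ᶠ_)
open import Data.Fin.Subset using (Subset; _∈_)
open import Data.Nat.Base
open import Data.Nat.DivMod
  using (_/_; _%_; m≡m%n+[m/n]*n; m%n<n; m<n⇒m/n≡0; m/n≡1+[m∸n]/n; m<n*o⇒m/o<n)
open import Data.Nat.Divisibility using (_∣_; m%n≡0⇒n∣m)
open import Data.Nat.Induction using (<-wellFounded)
open import Data.Nat.Properties
open import Data.Product using (∃; ∃₂; ∃-syntax; _×_; _,_; proj₁; proj₂)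
open import Data.Vec.Base using (Vec; []; _∷_; lookup; tabulate)
open import Data.Vec.Functional using (removeAt)
open import Data.Vec.Properties using (lookup∘tabulate; lookup⇒[]=; []=⇒lookup)
open import Function.Base using (_∘_)
open import Function.Bundles using (_⇔_; mk⇔; Equivalence; Injection)
open import Function.Properties.Inverse using (↔⇒↣)
open import Induction.WellFounded using (Acc; acc)
open import Relation.Binary.Definitions using (DecidableEquality; tri<; tri≈; tri>)
open import Relation.Binary.PropositionalEquality
open import Relation.Nullary
  using (Dec; yes; no; ¬_; does; proof; invert; Reflects; contradiction)
open import Relation.Nullary.Decidable using (dec-true)
open import Relation.Unary using (Pred; Decidable)
open import Algebra.Properties.CommutativeSemigroup +-commutativeSemigroup using (x∙yz≈xz∙y)
open import Algebra.Properties.Semiring.Sum +-*-semiring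
  using (sum; sum-syntax; sum-cong-≗; sum-replicate-zero; sum-remove; ∑-comm; *-distribʳ-sum)

open import Defs

open ≡-Reasoning

𝟙 : ∀ {p} {P : Set p} → Dec P → ℕ
𝟙 (yes _) = 1
𝟙 (no _)  = 0

𝟙-yes : ∀ {p} {P : Set p} (P? : Dec P) → P → 𝟙 P? ≡ 1
𝟙-yes (yes _) _ = refl
𝟙-yes (no ¬p) p = contradiction p ¬p

𝟙-no : ∀ {p} {P : Set p} (P? : Dec P) → ¬ P → 𝟙 P? ≡ 0
𝟙-no (yes p) ¬p = contradiction p ¬p
𝟙-no (no _)  _  = refl

𝟙-cong : ∀ {p q} {P : Set p} {Q : Set q} (P? : Dec P) (Q? : Dec Q) →
         (P → Q) → (Q → P) → 𝟙 P? ≡ 𝟙 Q?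
𝟙-cong (yes p) Q? P→Q _   = sym (𝟙-yes Q? (P→Q p))
𝟙-cong (no ¬p) Q? _   Q→P = sym (𝟙-no Q? (¬p ∘ Q→P))

∑-const : ∀ n c → ∑[ i < n ] c ≡ n * c
∑-const zero    c = refl
∑-const (suc n) c = cong (c +_) (∑-const n c)

∑-zero : ∀ {n} (f : Fin n → ℕ) → (∀ i → f i ≡ 0) → ∑[ i < n ] f i ≡ 0
∑-zero {n} f f≡0 = trans (sum-cong-≗ f≡0) (sum-replicate-zero n)

∑-single : ∀ {n} (f : Fin n → ℕ) (i₀ : Fin n) →
           (∀ i → i ≢ i₀ → f i ≡ 0) → ∑[ i < n ] f i ≡ f i₀
∑-single {suc n} f i₀ f≡0 = begin
  sum f                        ≡⟨ sum-remove {i = i₀} f ⟩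
  f i₀ + sum (removeAt f i₀)   ≡⟨ cong (f i₀ +_) (∑-zero _ (f≡0 _ ∘ punchInᵢ≢i i₀)) ⟩
  f i₀ + 0                     ≡⟨ +-identityʳ (f i₀) ⟩
  f i₀                         ∎

∑-𝟙≡𝟙-any : ∀ {n p} {P : Pred (Fin n) p} (P? : Decidable P) →
            (∀ {s t} → P s → P t → s ≡ t) → ∑[ t < n ] 𝟙 (P? t) ≡ 𝟙 (any? P?)
∑-𝟙≡𝟙-any P? unique with any? P?
... | yes (t₀ , p₀) =
  trans (∑-single _ t₀ (λ t t≢t₀ → 𝟙-no (P? t) (λ p → t≢t₀ (unique p p₀)))) (𝟙-yes (P? t₀) p₀)
... | no ¬∃        = ∑-zero _ (λ t → 𝟙-no (P? t) (λ p → ¬∃ (t , p)))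

∑-+ : ∀ a b (g : ℕ → ℕ) →
      ∑[ x < a + b ] g (toℕ x) ≡ ∑[ x < a ] g (toℕ x) + ∑[ x < b ] g (a + toℕ x)
∑-+ zero    b g = refl
∑-+ (suc a) b g = trans (cong (g 0 +_) (∑-+ a b (g ∘ suc))) (sym (+-assoc (g 0) _ _))

module _ {N j} {len : Fin j → ℕ} (g : ∀ i → Fin (len i) → Fin N)
  (surjective : ∀ y → ∃₂ λ i t → g i t ≡ y)
  (injectiveˡ : ∀ {i i′ s t} → g i s ≡ g i′ t → i ≡ i′)
  (injectiveʳ : ∀ {i s t} → g i s ≡ g i t → s ≡ t)
  where

  private
    fibre-size : ∀ y → ∑[ i < j ] ∑[ t < len i ] 𝟙 (g i t ≟ᶠ y) ≡ 1
    fibre-size y = begin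
      ∑[ i < j ] ∑[ t < len i ] 𝟙 (g i t ≟ᶠ y)
        ≡⟨ sum-cong-≗ (λ i → ∑-𝟙≡𝟙-any (λ t → g i t ≟ᶠ y)
                                        (λ p q → injectiveʳ (trans p (sym q)))) ⟩
      ∑[ i < j ] 𝟙 (any? λ t → g i t ≟ᶠ y)
        ≡⟨ ∑-𝟙≡𝟙-any (λ i → any? λ t → g i t ≟ᶠ y)
                      (λ (_ , p) (_ , q) → injectiveˡ (trans p (sym q))) ⟩
      𝟙 (any? λ i → any? λ t → g i t ≟ᶠ y)
        ≡⟨ 𝟙-yes _ (surjective y) ⟩
      1 ∎

    spread : ∀ (f : Fin N → ℕ) y → f y ≡ ∑[ i < j ] ∑[ t < len i ] (𝟙 (g i t ≟ᶠ y) * f y)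
    spread f y = begin
      f y
        ≡⟨ sym (*-identityˡ (f y)) ⟩
      1 * f y
        ≡⟨ cong (_* f y) (sym (fibre-size y)) ⟩
      (∑[ i < j ] ∑[ t < len i ] 𝟙 (g i t ≟ᶠ y)) * f y
        ≡⟨ *-distribʳ-sum (f y) (λ i → ∑[ t < len i ] 𝟙 (g i t ≟ᶠ y)) ⟩
      ∑[ i < j ] ((∑[ t < len i ] 𝟙 (g i t ≟ᶠ y)) * f y)
        ≡⟨ sum-cong-≗ (λ i → *-distribʳ-sum (f y) (λ t → 𝟙 (g i t ≟ᶠ y))) ⟩
      ∑[ i < j ] ∑[ t < len i ] (𝟙 (g i t ≟ᶠ y) * f y) ∎

    ∑-δ : ∀ (f : Fin N → ℕ) a → ∑[ y < N ] (𝟙 (a ≟ᶠ y) * f y) ≡ f a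
    ∑-δ f a = begin
      ∑[ y < N ] (𝟙 (a ≟ᶠ y) * f y)
        ≡⟨ ∑-single _ a (λ y y≢a → cong (_* f y) (𝟙-no (a ≟ᶠ y) (y≢a ∘ sym))) ⟩
      𝟙 (a ≟ᶠ a) * f a
        ≡⟨ cong (_* f a) (𝟙-yes (a ≟ᶠ a) refl) ⟩
      1 * f a
        ≡⟨ *-identityˡ (f a) ⟩
      f a ∎

  ∑-partition : ∀ (f : Fin N → ℕ) → ∑[ y < N ] f y ≡ ∑[ i < j ] ∑[ t < len i ] f (g i t)
  ∑-partition f = begin
    ∑[ y < N ] f y
      ≡⟨ sum-cong-≗ (spread f) ⟩
    ∑[ y < N ] ∑[ i < j ] ∑[ t < len i ] (𝟙 (g i t ≟ᶠ y) * f y)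
      ≡⟨ ∑-comm (λ y i → ∑[ t < len i ] (𝟙 (g i t ≟ᶠ y) * f y)) ⟩
    ∑[ i < j ] ∑[ y < N ] ∑[ t < len i ] (𝟙 (g i t ≟ᶠ y) * f y)
      ≡⟨ sum-cong-≗ (λ i → ∑-comm (λ y t → 𝟙 (g i t ≟ᶠ y) * f y)) ⟩
    ∑[ i < j ] ∑[ t < len i ] ∑[ y < N ] (𝟙 (g i t ≟ᶠ y) * f y)
      ≡⟨ sum-cong-≗ (λ i → sum-cong-≗ (λ t → ∑-δ f (g i t))) ⟩
    ∑[ i < j ] ∑[ t < len i ] f (g i t) ∎

least : ∀ {p} {P : Pred ℕ p} → Decidable P → ∀ {n} → P n →
        ∃ λ m → P m × (∀ {s} → s < m → ¬ P s)
least {P = P} P? {n} Pn = go n (<-wellFounded n) Pn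
  where
  go : ∀ n → Acc _<_ n → P n → ∃ λ m → P m × (∀ {s} → s < m → ¬ P s)
  go n (acc smaller) Pn with anyUpTo? P? n
  ... | yes (m , m<n , Pm) = go m (smaller m<n) Pm
  ... | no ¬∃              = n , Pn , λ s<n Ps → ¬∃ (_ , s<n , Ps)

IsLeastPeriod : ∀ {a} {A : Set a} → (ℕ → A) → ℕ → Set a
IsLeastPeriod β e = 1 ≤ e × β e ≡ β 0 × (∀ s → 1 ≤ s → s < e → β s ≢ β 0)

leastPeriod : ∀ {a} {A : Set a} → DecidableEquality A → (β : ℕ → A) →
              ∀ {p} → 1 ≤ p → β p ≡ β 0 → ∃ (IsLeastPeriod β)
leastPeriod _≟_ β {suc p} _ βp≡β0 with least (λ u → β (suc u) ≟ β 0) βp≡β0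
... | u , β1+u≡β0 , below =
  suc u , s≤s z≤n , β1+u≡β0 , λ { (suc s) _ (s≤s s<u) → below s<u }

module LeastPeriod {a} {A : Set a} (β : ℕ → A)
  (suc-reflects : ∀ {s t} → β (suc s) ≡ β (suc t) → β s ≡ β t)
  (suc-preserves : ∀ {s t} → β s ≡ β t → β (suc s) ≡ β (suc t))
  {e} (period : IsLeastPeriod β e)
  where

  private
    instance
      e≢0 : NonZero e
      e≢0 = >-nonZero (proj₁ period)

  +-reflects : ∀ c {s t} → β (c + s) ≡ β (c + t) → β s ≡ β t
  +-reflects zero    eq = eq
  +-reflects (suc c) eq = +-reflects c (suc-reflects eq)

  +-preserves : ∀ c {s t} → β s ≡ β t → β (c + s) ≡ β (c + t)
  +-preserves zero    eq = eq
  +-preserves (suc c) eq = suc-preserves (+-preserves c eq)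

  periodic : ∀ t q → β (t + q * e) ≡ β t
  periodic t zero    = cong β (+-identityʳ t)
  periodic t (suc q) = begin
    β (t + (e + q * e))  ≡⟨ cong β (x∙yz≈xz∙y t e (q * e)) ⟩
    β (t + q * e + e)    ≡⟨ +-preserves (t + q * e) (proj₁ (proj₂ period)) ⟩
    β (t + q * e + 0)    ≡⟨ cong β (+-identityʳ (t + q * e)) ⟩
    β (t + q * e)        ≡⟨ periodic t q ⟩
    β t                  ∎

  β-mod : ∀ t → β t ≡ β (t % e)
  β-mod t = trans (cong β (m≡m%n+[m/n]*n t e)) (periodic (t % e) (t / e))

  β-reduce : ∀ t → ∃ λ (s : Fin e) → β t ≡ β (toℕ s)
  β-reduce t =
    fromℕ< (m%n<n t e) , trans (β-mod t) (cong β (sym (toℕ-fromℕ< (m%n<n t e))))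

  private
    β-distinct : ∀ {s t} → s < t → t < e → β s ≢ β t
    β-distinct {s} {t} s<t t<e βs≡βt =
      proj₂ (proj₂ period) (t ∸ s) (m<n⇒0<n∸m s<t) (≤-<-trans (m∸n≤m t s) t<e)
        (+-reflects s (begin
          β (s + (t ∸ s))  ≡⟨ cong β (m+[n∸m]≡n (<⇒≤ s<t)) ⟩
          β t              ≡⟨ sym βs≡βt ⟩
          β s              ≡⟨ cong β (sym (+-identityʳ s)) ⟩
          β (s + 0)        ∎))

  β-injective-below : ∀ {s t} → s < e → t < e → β s ≡ β t → s ≡ t
  β-injective-below {s} {t} s<e t<e βs≡βt with <-cmp s t
  ... | tri< s<t _ _ = contradiction βs≡βt (β-distinct s<t t<e)
  ... | tri≈ _ s≡t _ = s≡t
  ... | tri> _ _ t<s = contradiction (sym βs≡βt) (β-distinct t<s s<e)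

  period-∣ : ∀ {t} → β t ≡ β 0 → e ∣ t
  period-∣ {t} βt≡β0 =
    m%n≡0⇒n∣m t e (β-injective-below (m%n<n t e) (proj₁ period) (trans (sym (β-mod t)) βt≡β0))

module _ {N} (σ : Permutation′ N) where

  ^-+ : ∀ a b x → σ ^[ a + b ] x ≡ σ ^[ a ] (σ ^[ b ] x)
  ^-+ zero    b x = refl
  ^-+ (suc a) b x = cong (σ ⟨$⟩ʳ_) (^-+ a b x)

  ^-comm : ∀ a b x → σ ^[ a ] (σ ^[ b ] x) ≡ σ ^[ b ] (σ ^[ a ] x)
  ^-comm a b x = begin
    σ ^[ a ] (σ ^[ b ] x)  ≡⟨ sym (^-+ a b x) ⟩
    σ ^[ a + b ] x         ≡⟨ cong (σ ^[_] x) (+-comm a b) ⟩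
    σ ^[ b + a ] x         ≡⟨ ^-+ b a x ⟩
    σ ^[ b ] (σ ^[ a ] x)  ∎

select : ∀ {j p} {P : Pred (Fin j) p} → Decidable P → Subset j
select P? = tabulate (λ i → does (P? i))

∈-select : ∀ {j p} {P : Pred (Fin j) p} (P? : Decidable P) {i} → i ∈ select P? ⇔ P i
∈-select P? {i} = mk⇔
  (λ i∈ → invert (subst (Reflects _) (trans (sym (lookup∘tabulate _ i)) ([]=⇒lookup i∈))
                        (proof (P? i))))
  (λ Pi → lookup⇒[]= i _ (trans (lookup∘tabulate _ i) (dec-true (P? i) Pi)))

subsetSum-select : ∀ {j p} {P : Pred (Fin j) p} (P? : Decidable P) (n : Vec ℕ j) →
                   subsetSum (select P?) n ≡ ∑[ i < j ] (lookup n i * 𝟙 (P? i))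
subsetSum-select P? []      = refl
subsetSum-select P? (v ∷ n) with P? zero
... | yes _ = cong₂ _+_ (sym (*-identityʳ v)) (subsetSum-select (P? ∘ suc) n)
... | no _  = cong₂ _+_ (sym (*-zeroʳ v)) (subsetSum-select (P? ∘ suc) n)

module CycleType {N} (σ : Permutation′ N) {j} {n : Vec ℕ j} (cycleType : IsCycleType σ n) where

  private
    r : Fin j → Fin N
    r = proj₁ cycleType

    separated : ∀ i i′ t → σ ^[ t ] (r i) ≡ r i′ → i ≡ i′
    separated = proj₁ (proj₂ cycleType)

    covers : ∀ y → ∃₂ λ i t → σ ^[ t ] (r i) ≡ y
    covers = proj₁ (proj₂ (proj₂ cycleType))

    orbitLength : ∀ i → IsOrbitLength σ (r i) (lookup n i)
    orbitLength = proj₂ (proj₂ (proj₂ cycleType))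

    -- IsOrbitLength σ x is, definitionally, IsLeastPeriod of the sequence t ↦ σᵗ x.
    module Orbit i = LeastPeriod (λ t → σ ^[ t ] (r i))
                       (Injection.injective (↔⇒↣ σ)) (cong (σ ⟨$⟩ʳ_)) (orbitLength i)

    -- After t steps from rᵢ, another t·nᵢ − t steps complete t full turns of the orbit.
    return : ∀ i t → σ ^[ t * lookup n i ∸ t ] (σ ^[ t ] (r i)) ≡ r i
    return i t = begin
      σ ^[ t * lookup n i ∸ t ] (σ ^[ t ] (r i))  ≡⟨ sym (^-+ σ (t * lookup n i ∸ t) t (r i)) ⟩
      σ ^[ t * lookup n i ∸ t + t ] (r i)         ≡⟨ cong (σ ^[_] (r i)) (m∸n+n≡m t≤tnᵢ) ⟩
      σ ^[ t * lookup n i ] (r i)                 ≡⟨ Orbit.periodic i 0 t ⟩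
      r i                                         ∎
      where
      t≤tnᵢ : t ≤ t * lookup n i
      t≤tnᵢ = m≤m*n t (lookup n i) {{>-nonZero (proj₁ (orbitLength i))}}

  orbit : ∀ i → Fin (lookup n i) → Fin N
  orbit i t = σ ^[ toℕ t ] (r i)

  orbit-surjective : ∀ y → ∃₂ λ i t → orbit i t ≡ y
  orbit-surjective y with covers y
  ... | i , t , σᵗrᵢ≡y with Orbit.β-reduce i t
  ...   | s , σᵗrᵢ≡σˢrᵢ = i , s , trans (sym σᵗrᵢ≡σˢrᵢ) σᵗrᵢ≡y

  orbit-injectiveˡ : ∀ {i i′ s t} → orbit i s ≡ orbit i′ t → i ≡ i′
  orbit-injectiveˡ {i} {i′} {s} {t} eq = separated i i′ (c + toℕ s) (begin
    σ ^[ c + toℕ s ] (r i)   ≡⟨ ^-+ σ c (toℕ s) (r i) ⟩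
    σ ^[ c ] (orbit i s)     ≡⟨ cong (σ ^[ c ]_) eq ⟩
    σ ^[ c ] (orbit i′ t)    ≡⟨ return i′ (toℕ t) ⟩
    r i′                     ∎)
    where c = toℕ t * lookup n i′ ∸ toℕ t

  orbit-injectiveʳ : ∀ {i s t} → orbit i s ≡ orbit i t → s ≡ t
  orbit-injectiveʳ {i} {s} {t} eq =
    toℕ-injective (Orbit.β-injective-below i (toℕ<n s) (toℕ<n t) eq)

  ∑-orbits : ∀ (f : Fin N → ℕ) → ∑[ y < N ] f y ≡ ∑[ i < j ] ∑[ t < lookup n i ] f (orbit i t)
  ∑-orbits = ∑-partition orbit orbit-surjective
    (λ {i i′ s t} → orbit-injectiveˡ {i} {i′} {s} {t})
    (λ {i s t} → orbit-injectiveʳ {i} {s} {t})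

  subsetSum-invariant : ∀ {p} {P : Pred (Fin N) p} (P? : Decidable P) →
                        (∀ {y} → P y → P (σ ⟨$⟩ʳ y)) →
                        subsetSum (select (P? ∘ r)) n ≡ ∑[ y < N ] 𝟙 (P? y)
  subsetSum-invariant {P = P} P? invariant = begin
    subsetSum (select (P? ∘ r)) n
      ≡⟨ subsetSum-select (P? ∘ r) n ⟩
    ∑[ i < j ] (lookup n i * 𝟙 (P? (r i)))
      ≡⟨ sum-cong-≗ (λ i → sym (∑-const (lookup n i) _)) ⟩
    ∑[ i < j ] ∑[ t < lookup n i ] 𝟙 (P? (r i))
      ≡⟨ sum-cong-≗ (λ i → sum-cong-≗ (λ t → 𝟙-cong (P? (r i)) (P? (orbit i t))
                                                 (invariant^ (toℕ t)) (back-to-start i (toℕ t)))) ⟩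
    ∑[ i < j ] ∑[ t < lookup n i ] 𝟙 (P? (orbit i t))
      ≡⟨ sym (∑-orbits (𝟙 ∘ P?)) ⟩
    ∑[ y < N ] 𝟙 (P? y) ∎
    where
    invariant^ : ∀ t {y} → P y → P (σ ^[ t ] y)
    invariant^ zero    Py = Py
    invariant^ (suc t) Py = invariant (invariant^ t Py)

    back-to-start : ∀ i t → P (σ ^[ t ] (r i)) → P (r i)
    back-to-start i t = subst P (return i t) ∘ invariant^ (t * lookup n i ∸ t)

module _ (k : ℕ) .{{_ : NonZero k}} where

  [k+x]/k≡1+x/k : ∀ x → (k + x) / k ≡ suc (x / k)
  [k+x]/k≡1+x/k x = trans (m/n≡1+[m∸n]/n (m≤m+n k x)) (cong (λ y → suc (y / k)) (m+n∸m≡n k x))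

  private
    ∑-peel-block : ∀ ℓ (h : ℕ → ℕ) →
      ∑[ x < k * suc ℓ ] h (toℕ x) ≡ ∑[ x < k ] h (toℕ x) + ∑[ x < k * ℓ ] h (k + toℕ x)
    ∑-peel-block ℓ h = trans (cong (λ m → ∑[ x < m ] h (toℕ x)) (*-suc k ℓ)) (∑-+ k (k * ℓ) h)

  block-size : ∀ ℓ b → b < ℓ → ∑[ x < k * ℓ ] 𝟙 (block k ℓ x ≟ b) ≡ k
  block-size (suc ℓ) zero _ = begin
    ∑[ x < k * suc ℓ ] 𝟙 (toℕ x / k ≟ 0)
      ≡⟨ ∑-peel-block ℓ (λ y → 𝟙 (y / k ≟ 0)) ⟩
    ∑[ x < k ] 𝟙 (toℕ x / k ≟ 0) + ∑[ x < k * ℓ ] 𝟙 ((k + toℕ x) / k ≟ 0)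
      ≡⟨ cong₂ _+_ (sum-cong-≗ (λ x → 𝟙-yes (toℕ x / k ≟ 0) (m<n⇒m/n≡0 (toℕ<n x))))
                   (∑-zero {k * ℓ} _ (λ x → 𝟙-no ((k + toℕ x) / k ≟ 0)
                                                  (1+n≢0 ∘ trans (sym ([k+x]/k≡1+x/k (toℕ x)))))) ⟩
    ∑[ x < k ] 1 + 0
      ≡⟨ trans (+-identityʳ _) (trans (∑-const k 1) (*-identityʳ k)) ⟩
    k ∎
  block-size (suc ℓ) (suc b) (s≤s b<ℓ) = begin
    ∑[ x < k * suc ℓ ] 𝟙 (toℕ x / k ≟ suc b)
      ≡⟨ ∑-peel-block ℓ (λ y → 𝟙 (y / k ≟ suc b)) ⟩
    ∑[ x < k ] 𝟙 (toℕ x / k ≟ suc b) + ∑[ x < k * ℓ ] 𝟙 ((k + toℕ x) / k ≟ suc b)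
      ≡⟨ cong₂ _+_ (∑-zero _ (λ x → 𝟙-no (toℕ x / k ≟ suc b)
                                         (0≢1+n ∘ trans (sym (m<n⇒m/n≡0 (toℕ<n x))))))
                   (sum-cong-≗ {k * ℓ} (λ x → 𝟙-cong ((k + toℕ x) / k ≟ suc b) (toℕ x / k ≟ b)
                      (suc-injective ∘ trans (sym ([k+x]/k≡1+x/k (toℕ x))))
                      (trans ([k+x]/k≡1+x/k (toℕ x)) ∘ cong suc))) ⟩
    0 + ∑[ x < k * ℓ ] 𝟙 (toℕ x / k ≟ b)
      ≡⟨ block-size ℓ b b<ℓ ⟩
    k ∎

module Wreath (k ℓ : ℕ) .{{_ : NonZero k}} (σ : Permutation′ (k * ℓ)) (σ∈W : InWreath k ℓ σ) where

  block-< : ∀ x → block k ℓ x < ℓ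
  block-< x = m<n*o⇒m/o<n (subst (toℕ x <_) (*-comm k ℓ) (toℕ<n x))

  σ-preserves-block : ∀ {x y} → block k ℓ x ≡ block k ℓ y →
                      block k ℓ (σ ⟨$⟩ʳ x) ≡ block k ℓ (σ ⟨$⟩ʳ y)
  σ-preserves-block {x} {y} eq with σ∈W (block k ℓ x) (block-< x)
  ... | _ , _ , image =
    trans (Equivalence.from (image x) refl) (sym (Equivalence.from (image y) (sym eq)))

  σ-reflects-block : ∀ {x y} → block k ℓ (σ ⟨$⟩ʳ x) ≡ block k ℓ (σ ⟨$⟩ʳ y) →
                     block k ℓ x ≡ block k ℓ y
  σ-reflects-block {x} {y} eq with σ∈W (block k ℓ x) (block-< x)
  ... | _ , _ , image =
    sym (Equivalence.to (image y) (trans (sym eq) (Equivalence.from (image x) refl)))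

  ^-preserves-block : ∀ t {x y} → block k ℓ x ≡ block k ℓ y →
                      block k ℓ (σ ^[ t ] x) ≡ block k ℓ (σ ^[ t ] y)
  ^-preserves-block zero    eq = eq
  ^-preserves-block (suc t) eq = σ-preserves-block (^-preserves-block t eq)

  ^-reflects-block : ∀ t {x y} → block k ℓ (σ ^[ t ] x) ≡ block k ℓ (σ ^[ t ] y) →
                     block k ℓ x ≡ block k ℓ y
  ^-reflects-block zero    eq = eq
  ^-reflects-block (suc t) eq = ^-reflects-block t (σ-reflects-block eq)

  blockPeriod : ∀ {x m} → IsOrbitLength σ x m →
                ∃ (IsLeastPeriod (λ t → block k ℓ (σ ^[ t ] x)))
  blockPeriod (1≤m , σᵐx≡x , _) = leastPeriod _≟_ _ 1≤m (cong (block k ℓ) σᵐx≡x)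

  module BlockOrbit (x₀ : Fin (k * ℓ)) {e}
                    (period : IsLeastPeriod (λ t → block k ℓ (σ ^[ t ] x₀)) e) where

    private
      β : ℕ → ℕ
      β t = block k ℓ (σ ^[ t ] x₀)

    open LeastPeriod β σ-reflects-block σ-preserves-block period

    Visited : Pred (Fin (k * ℓ)) _
    Visited y = ∃ λ (t : Fin e) → block k ℓ y ≡ β (toℕ t)

    visited? : Decidable Visited
    visited? y = any? (λ t → block k ℓ y ≟ β (toℕ t))

    visited-start : Visited x₀
    visited-start = β-reduce 0

    visited-σ : ∀ {y} → Visited y → Visited (σ ⟨$⟩ʳ y)
    visited-σ (t , eq) with β-reduce (suc (toℕ t))
    ... | s , β1+t≡βs = s , trans (σ-preserves-block eq) β1+t≡βs

    ∑-visited : ∑[ y < k * ℓ ] 𝟙 (visited? y) ≡ e * k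
    ∑-visited = begin
      ∑[ y < k * ℓ ] 𝟙 (visited? y)
        ≡⟨ sum-cong-≗ (λ y → sym (∑-𝟙≡𝟙-any (λ t → block k ℓ y ≟ β (toℕ t))
             (λ p q → toℕ-injective (β-injective-below (toℕ<n _) (toℕ<n _) (trans (sym p) q))))) ⟩
      ∑[ y < k * ℓ ] ∑[ t < e ] 𝟙 (block k ℓ y ≟ β (toℕ t))
        ≡⟨ ∑-comm {k * ℓ} {e} (λ y t → 𝟙 (block k ℓ y ≟ β (toℕ t))) ⟩
      ∑[ t < e ] ∑[ y < k * ℓ ] 𝟙 (block k ℓ y ≟ β (toℕ t))
        ≡⟨ sum-cong-≗ {e} (λ t → block-size k ℓ (β (toℕ t)) (block-< _)) ⟩
      ∑[ t < e ] k
        ≡⟨ ∑-const e k ⟩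
      e * k ∎

    period-∣-orbitLength : ∀ {y m} → IsOrbitLength σ y m → Visited y → e ∣ m
    period-∣-orbitLength {y} {m} (_ , σᵐy≡y , _) (t , eq) =
      period-∣ (^-reflects-block (toℕ t) (begin
      block k ℓ (σ ^[ toℕ t ] (σ ^[ m ] x₀))  ≡⟨ cong (block k ℓ) (^-comm σ (toℕ t) m x₀) ⟩
      block k ℓ (σ ^[ m ] (σ ^[ toℕ t ] x₀))  ≡⟨ ^-preserves-block m (sym eq) ⟩
      block k ℓ (σ ^[ m ] y)                  ≡⟨ cong (block k ℓ) σᵐy≡y ⟩
      block k ℓ y                             ≡⟨ eq ⟩
      block k ℓ (σ ^[ toℕ t ] x₀)             ∎))

mainTheorem3 : ∀ (k ℓ : ℕ) .{{_ : NonZero k}} → 1 ≤ ℓ →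
    (σ : Permutation′ (k * ℓ)) → InWreath k ℓ σ →
    ∀ {j} (n : Vec ℕ j) → IsCycleType σ n →
    ∀ (m : Fin j) → ∃[ e ] ∃[ I ] (1 ≤ e × m ∈ I ×
      (∀ (i : Fin j) → i ∈ I → e ∣ lookup n i) ×
      subsetSum I n ≡ e * k)
mainTheorem3 k ℓ _ σ σ∈W {j} n cycleType@(r , _ , _ , orbitLength) m =
  e , I , proj₁ period , Equivalence.from (∈-select (visited? ∘ r)) visited-start ,
  (λ i i∈I → period-∣-orbitLength (orbitLength i) (Equivalence.to (∈-select (visited? ∘ r)) i∈I)) ,
  (begin
    subsetSum I n                  ≡⟨ subsetSum-invariant visited? visited-σ ⟩
    ∑[ y < k * ℓ ] 𝟙 (visited? y)  ≡⟨ ∑-visited ⟩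
    e * k                          ∎)
  where
  open Wreath k ℓ σ σ∈W
  open CycleType σ {n = n} cycleType
  e : ℕ
  e = proj₁ (blockPeriod (orbitLength m))
  period : IsLeastPeriod (λ t → block k ℓ (σ ^[ t ] r m)) e
  period = proj₂ (blockPeriod (orbitLength m))
  open BlockOrbit (r m) period

  I : Subset j
  I = select (visited? ∘ r)
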